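{- Let $n,a\in\mathbb{N}$ and let $n=p_1^{e_1}\cdots p_l^{e_l}$ be the prime factorization of $n$. Then (1) $\operatorname{lev}_n(a)=\max_{i\in\{1,\dots,l\}}\operatorname{lev}_{p_i^{e_i}}(a)$; (2) if $a$ is coprime to $L(n)$, then $\operatorname{lev}_n(a)=\operatorname{lev}_n(r)$, where $r$ is the least nonnegative residue of $a$ modulo $L_a(n)$.
   Context: Tetration: ${}^0a=1$, ${}^ka=a^{({}^{k-1}a)}$. $\lambda$ is Carmichael's function, $\lambda^{(0)}(n)=n$, $\lambda^{(k)}=\lambda\circ\lambda^{(k-1)}$, $H(n)=\min\{\alpha:\lambda^{(\alpha)}(n)=1\}$, $L(n)=\operatorname{lcm}\{n,\lambda(n),\dots,\lambda^{(H(n))}(n)\}$. $\operatorname{lev}_n(a)$ is the least $t\ge0$ with ${}^ka\equiv{}^ta\pmod n$ for all $k\ge t$. $V(a,n)$ is the largest divisor of $n$ coprime to $a$. Iterated orders: $\operatorname{ord}_n^{(0)}(a)=n$ and $\operatorname{ord}_n^{(k)}(a)=\operatorname{ord}_{V(a,\operatorname{ord}_n^{(k-1)}(a))}(a)$ for $k\in\mathbb{N}$, where $\operatorname{ord}_m(a)$ is the multiplicative order of $a$ modulo $m$ (with $\operatorname{ord}_1(a)=1$); $L_a(n)$ is the least common multiple of all $\operatorname{ord}_n^{(i)}(a)$, $i\ge0$. -}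

module Defs where

open import Data.Bool using (Bool; true; false; if_then_else_; _∧_; _∨_; not)
open import Data.Nat using (ℕ; zero; suc; _+_; _*_; _^_; _≤_; _⊔_; ∣_-_∣; _≟_)
open import Data.Nat.Divisibility using (_∣_; _∣?_)
open import Data.Nat.GCD using (gcd)
open import Data.Nat.LCM using (lcm)
open import Data.Fin using (Fin)
import Data.Fin as Fin
open import Data.Product using (_×_)
open import Relation.Nullary using (does)

ModEq : ℕ → ℕ → ℕ → Set
ModEq n x y = n ∣ ∣ x - y ∣

modEq? : ℕ → ℕ → ℕ → Bool
modEq? n x y = does (n ∣? ∣ x - y ∣)

coprime? : ℕ → ℕ → Bool
coprime? x y = does (gcd x y ≟ 1)

tet : ℕ → ℕ → ℕ
tet a zero    = 1
tet a (suc k) = a ^ tet a k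

-- lev_n(a): the least t ≥ 0 with ᵏa ≡ ᵗa (mod n) for all k ≥ t.
-- Given relationally: IsLev n a t  says  t = lev_n(a).

Stable : ℕ → ℕ → ℕ → Set
Stable n a t = ∀ k → t ≤ k → ModEq n (tet a k) (tet a t)

IsLev : ℕ → ℕ → ℕ → Set
IsLev n a t = Stable n a t × (∀ s → Stable n a s → t ≤ s)

-- first m in [start, start + fuel) with P m; start + fuel if none
firstFrom : (ℕ → Bool) → ℕ → ℕ → ℕ
firstFrom P start zero       = start
firstFrom P start (suc fuel) =
  if P start then start else firstFrom P (suc start) fuel

-- largest d ≤ m with P d; 0 if none
lastUpTo : (ℕ → Bool) → ℕ → ℕ
lastUpTo P zero    = zero
lastUpTo P (suc d) = if P (suc d) then suc d else lastUpTo P d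

allBelow : (ℕ → Bool) → ℕ → Bool
allBelow P zero    = true
allBelow P (suc m) = P m ∧ allBelow P m

iter : (ℕ → ℕ) → ℕ → ℕ → ℕ
iter f zero    x = x
iter f (suc k) x = f (iter f k x)

lcmUpTo : (ℕ → ℕ) → ℕ → ℕ
lcmUpTo f zero    = f zero
lcmUpTo f (suc k) = lcm (lcmUpTo f k) (f (suc k))

-- It suffices to
-- test residues x < n, and λ(n) ≤ n, so the search over m ∈ [1, n] is
-- exhaustive (the fall-back value is never reached for n ≥ 1).

carmichael : ℕ → ℕ
carmichael n =
  firstFrom (λ m → allBelow (λ x → not (coprime? x n) ∨ modEq? n (x ^ m) 1) n) 1 n

carmichaelIter : ℕ → ℕ → ℕ
carmichaelIter k n = iter carmichael k n

-- H(n) = min { α : λ^(α)(n) = 1 }   (α ≤ n always suffices since λ(m) < m for m > 1)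
H : ℕ → ℕ
H n = firstFrom (λ α → does (carmichaelIter α n ≟ 1)) 0 (suc n)

Lc : ℕ → ℕ
Lc n = lcmUpTo (λ α → carmichaelIter α n) (H n)

V : ℕ → ℕ → ℕ
V a m = lastUpTo (λ d → does (d ∣? m) ∧ coprime? d a) m

-- ord_m(a): least k ≥ 1 with a^k ≡ 1 (mod m)  (used for a coprime to m;
-- ord_1(a) = 1; the order is ≤ m so the search over [1, m] is exhaustive)
ord : ℕ → ℕ → ℕ
ord m a = firstFrom (λ k → modEq? m (a ^ k) 1) 1 m

ordIter : ℕ → ℕ → ℕ → ℕ
ordIter zero    n a = n
ordIter (suc k) n a = ord (V a (ordIter k n a)) a

-- L_a(n) = lcm of all ord^(i)_n(a), i ≥ 0.  The sequence is strictly
-- decreasing until it reaches 1 and then stays 1, so i ≤ n suffices.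
La : ℕ → ℕ → ℕ
La a n = lcmUpTo (λ i → ordIter i n a) n

prodF : ∀ {l} → (Fin l → ℕ) → ℕ
prodF {zero}  f = 1
prodF {suc l} f = f Fin.zero * prodF (λ i → f (Fin.suc i))

maxF : ∀ {l} → (Fin l → ℕ) → ℕ
maxF {zero}  f = 0
maxF {suc l} f = f Fin.zero ⊔ maxF (λ i → f (Fin.suc i))

{-# OPTIONS --safe #-}

-- (1) The tower is stable from level t modulo n exactly when it is stable from t modulo each
-- of the pairwise coprime prime powers p_i^e_i, and stability from t persists to every t' ≥ t;
-- so the least stable level modulo n is the largest of the least stable levels modulo p_i^e_i.
--
-- (2) Put m_i = ord^(i)_n(a). By induction m_i divides λ^(i)(n), which is 1 or a divisor of
-- L(n), so a is coprime to every m_i; hence m_(i+1) = ord_(m_i)(a), i.e. a^(m_(i+1)) ≡ 1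
-- (mod m_i), and a ≡ r (mod m_i) since each m_i divides L_a(n). Now ᵏa ≡ ᵏr (mod m_i) for
-- all k and i, by induction on k: a^x ≡ r^x (mod m_i), and r^x ≡ r^y (mod m_i) whenever
-- x ≡ y (mod m_(i+1)). At i = 0 the towers of a and r agree modulo n, so they have the same
-- level. The facts about λ and ord used here all come from Euler's theorem.

module Submission where

open import Defs
open import Data.Nat
open import Data.Nat.Properties
open import Data.Nat.Divisibility
open import Data.Nat.DivMod hiding (_mod_)
open import Data.Nat.Coprimality as Coprimality using (Coprime; coprime-divisor; coprime⇒gcd≡1; gcd≡1⇒coprime)
open import Data.Nat.GCD using (gcd)
open import Data.Nat.LCM using (lcm; m∣lcm[m,n]; n∣lcm[m,n]; lcm-least; gcd*lcm)
open import Data.Bool using (Bool; true; false; _∨_; not)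
open import Data.List using (List; []; _∷_; _++_; map; filter; length; upTo)
open import Data.List.Properties using (length-map; length-upTo; length-++-sucʳ; length-filter; filter-notAll; filter-some)
open import Data.List.Membership.Propositional using (_∈_; lose)
open import Data.List.Membership.Propositional.Properties using (∈-∃++; ∈-++⁻; ∈-++⁺ˡ; ∈-++⁺ʳ; ∈-map⁻; ∈-filter⁺; ∈-filter⁻; ∈-upTo⁺; ∈-upTo⁻)
open import Data.List.Relation.Unary.Any using (here; there)
import Data.List.Relation.Unary.All as All
open import Data.List.Relation.Unary.AllPairs using (_∷_)
import Data.List.Relation.Unary.AllPairs.Properties as AllPairs
open import Data.List.Relation.Unary.Unique.Propositional using (Unique)
open import Data.List.Relation.Binary.Subset.Propositional using (_⊆_)
open import Data.List.Relation.Binary.Permutation.Propositional using (_↭_; ↭-refl; ↭-prep; ↭-sym; ↭-trans)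
open import Data.List.Relation.Binary.Permutation.Propositional.Properties using (shift)
open import Data.Nat.ListAction using (product)
open import Data.Nat.ListAction.Properties using (product-↭)
open import Data.Sum using (_⊎_; inj₁; inj₂)
open import Data.Fin using (Fin)
import Data.Fin as Fin
import Data.Fin.Properties as Finₚ
open import Data.Product using (_×_; _,_; proj₁; proj₂)
open import Data.Nat.Primality using (Prime; prime⇒nonZero)
open import Function using (id; _∘_)
open import Level using (0ℓ)
open import Relation.Binary.Bundles using (Setoid)
open import Relation.Binary.Definitions using (tri<; tri≈; tri>)
open import Relation.Binary.PropositionalEquality
open import Relation.Nullary using (Dec; yes; no; does; ¬_; contradiction)
open import Relation.Nullary.Decidable using (dec-true)
open import Relation.Unary using (Decidable)
import Relation.Binary.Reasoning.Setoid as SetoidReasoning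

-- Congruences

-- A record rather than ModEq itself, so that x and y can be inferred.
infix 4 _≡_mod_
record _≡_mod_ (x y m : ℕ) : Set where
  constructor mk≡mod
  field ∣-diff : ModEq m x y
open _≡_mod_

module _ {m : ℕ} where

  ≡⇒≡-mod : ∀ {x y} → x ≡ y → x ≡ y mod m
  ≡⇒≡-mod {x} refl = mk≡mod (subst (m ∣_) (sym (∣n-n∣≡0 x)) (m ∣0))

  ≡-mod-refl : ∀ {x} → x ≡ x mod m
  ≡-mod-refl = ≡⇒≡-mod refl

  ≡-mod-sym : ∀ {x y} → x ≡ y mod m → y ≡ x mod m
  ≡-mod-sym {x} {y} (mk≡mod d) = mk≡mod (subst (m ∣_) (∣-∣-comm x y) d)

≡-mod-0⇒≡ : ∀ {x y} → x ≡ y mod 0 → x ≡ y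
≡-mod-0⇒≡ (mk≡mod d) = ∣m-n∣≡0⇒m≡n (0∣⇒≡0 d)

module _ {m : ℕ} .{{_ : NonZero m}} where

  %-≡⇒≡-mod : ∀ {x y} → x % m ≡ y % m → x ≡ y mod m
  %-≡⇒≡-mod {x} {y} eq = mk≡mod (subst (m ∣_) (sym diff≡) (n∣m*n ∣ x / m - y / m ∣))
    where
    open ≡-Reasoning
    diff≡ : ∣ x - y ∣ ≡ ∣ x / m - y / m ∣ * m
    diff≡ = begin
      ∣ x - y ∣                                     ≡⟨ cong₂ ∣_-_∣ (m≡m%n+[m/n]*n x m) (m≡m%n+[m/n]*n y m) ⟩
      ∣ x % m + x / m * m - y % m + y / m * m ∣     ≡⟨ cong (λ r → ∣ x % m + x / m * m - r + y / m * m ∣) (sym eq) ⟩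
      ∣ x % m + x / m * m - x % m + y / m * m ∣     ≡⟨ ∣m+n-m+o∣≡∣n-o∣ (x % m) _ _ ⟩
      ∣ x / m * m - y / m * m ∣                     ≡⟨ sym (*-distribʳ-∣-∣ m (x / m) (y / m)) ⟩
      ∣ x / m - y / m ∣ * m                         ∎

  private
    ≥-≡-mod⇒%-≡ : ∀ {x y} → y ≤ x → x ≡ y mod m → x % m ≡ y % m
    ≥-≡-mod⇒%-≡ {x} {y} y≤x (mk≡mod d) = begin
      x % m             ≡⟨ cong (_% m) (sym (m+[n∸m]≡n y≤x)) ⟩
      (y + (x ∸ y)) % m ≡⟨ %-remove-+ʳ y (subst (m ∣_) (m≤n⇒∣n-m∣≡n∸m y≤x) d) ⟩
      y % m             ∎
      where open ≡-Reasoning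

  ≡-mod⇒%-≡ : ∀ {x y} → x ≡ y mod m → x % m ≡ y % m
  ≡-mod⇒%-≡ {x} {y} c with ≤-total y x
  ... | inj₁ y≤x = ≥-≡-mod⇒%-≡ y≤x c
  ... | inj₂ x≤y = sym (≥-≡-mod⇒%-≡ x≤y (≡-mod-sym c))

≡-mod-trans : ∀ {m x y z} → x ≡ y mod m → y ≡ z mod m → x ≡ z mod m
≡-mod-trans {zero}  p q = subst (_≡ _ mod 0) (sym (≡-mod-0⇒≡ p)) q
≡-mod-trans {suc m} p q = %-≡⇒≡-mod (trans (≡-mod⇒%-≡ p) (≡-mod⇒%-≡ q))

≡-mod-setoid : ℕ → Setoid 0ℓ 0ℓ
≡-mod-setoid m = record
  { Carrier = ℕ
  ; _≈_ = λ x y → x ≡ y mod m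
  ; isEquivalence = record { refl = ≡-mod-refl ; sym = ≡-mod-sym ; trans = ≡-mod-trans }
  }

module ≡-mod-Reasoning (m : ℕ) = SetoidReasoning (≡-mod-setoid m)

≡-mod-∣ : ∀ {d m x y} → d ∣ m → x ≡ y mod m → x ≡ y mod d
≡-mod-∣ d∣m (mk≡mod m∣diff) = mk≡mod (∣-trans d∣m m∣diff)

≡-mod-1 : ∀ {x y} → x ≡ y mod 1
≡-mod-1 = mk≡mod (1∣ _)

≡-mod-% : ∀ {m} x .{{_ : NonZero m}} → x ≡ x % m mod m
≡-mod-% {m} x = %-≡⇒≡-mod (sym (m%n%n≡m%n x m))

*-cong-mod : ∀ {m x y u v} → x ≡ y mod m → u ≡ v mod m → x * u ≡ y * v mod m
*-cong-mod {zero} p q = ≡⇒≡-mod (cong₂ _*_ (≡-mod-0⇒≡ p) (≡-mod-0⇒≡ q))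
*-cong-mod {suc m} {x} {y} {u} {v} p q = %-≡⇒≡-mod (begin
  x * u % suc m                           ≡⟨ %-distribˡ-* x u (suc m) ⟩
  (x % suc m) * (u % suc m) % suc m       ≡⟨ cong₂ (λ r s → r * s % suc m) (≡-mod⇒%-≡ p) (≡-mod⇒%-≡ q) ⟩
  (y % suc m) * (v % suc m) % suc m       ≡⟨ %-distribˡ-* y v (suc m) ⟨
  y * v % suc m                           ∎)
  where open ≡-Reasoning

^-cong-mod : ∀ {m x y} k → x ≡ y mod m → x ^ k ≡ y ^ k mod m
^-cong-mod zero    _ = ≡-mod-refl
^-cong-mod (suc k) p = *-cong-mod p (^-cong-mod k p)

*-cancelˡ-mod : ∀ {m c x y} → Coprime m c → c * x ≡ c * y mod m → x ≡ y mod m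
*-cancelˡ-mod {m} {c} {x} {y} m⊥c (mk≡mod d) =
  mk≡mod (coprime-divisor m⊥c (subst (m ∣_) (sym (*-distribˡ-∣-∣ c x y)) d))

^-%-mod : ∀ {m b k} x .{{_ : NonZero k}} → b ^ k ≡ 1 mod m → b ^ x ≡ b ^ (x % k) mod m
^-%-mod {m} {b} {k} x bᵏ≡1 = begin
  b ^ x                               ≡⟨ cong (b ^_) (m≡m%n+[m/n]*n x k) ⟩
  b ^ (x % k + x / k * k)             ≡⟨ ^-distribˡ-+-* b (x % k) _ ⟩
  b ^ (x % k) * b ^ (x / k * k)       ≡⟨ cong (λ e → b ^ (x % k) * b ^ e) (*-comm (x / k) k) ⟩
  b ^ (x % k) * b ^ (k * (x / k))     ≡⟨ cong (b ^ (x % k) *_) (^-*-assoc b k (x / k)) ⟨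
  b ^ (x % k) * (b ^ k) ^ (x / k)     ≈⟨ *-cong-mod (≡-mod-refl {x = b ^ (x % k)}) (^-cong-mod (x / k) bᵏ≡1) ⟩
  b ^ (x % k) * 1 ^ (x / k)           ≡⟨ cong (b ^ (x % k) *_) (^-zeroˡ (x / k)) ⟩
  b ^ (x % k) * 1                     ≡⟨ *-identityʳ _ ⟩
  b ^ (x % k)                         ∎
  where open ≡-mod-Reasoning m

^-cong-exponent : ∀ {m b k x y} → b ^ k ≡ 1 mod m → x ≡ y mod k → b ^ x ≡ b ^ y mod m
^-cong-exponent {k = zero}  _ x≡y = ≡⇒≡-mod (cong (_ ^_) (≡-mod-0⇒≡ x≡y))
^-cong-exponent {m} {b} {suc k} {x} {y} bᵏ≡1 x≡y = begin
  b ^ x             ≈⟨ ^-%-mod x bᵏ≡1 ⟩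
  b ^ (x % suc k)   ≡⟨ cong (b ^_) (≡-mod⇒%-≡ x≡y) ⟩
  b ^ (y % suc k)   ≈⟨ ^-%-mod y bᵏ≡1 ⟨
  b ^ y             ∎
  where open ≡-mod-Reasoning m

-- Bounded search

does⇒ : ∀ {P : Set} (P? : Dec P) → does P? ≡ true → P
does⇒ (yes p) _ = p

firstFrom-≥ : ∀ P start fuel → start ≤ firstFrom P start fuel
firstFrom-≥ P start zero = ≤-refl
firstFrom-≥ P start (suc fuel) with P start
... | true  = ≤-refl
... | false = ≤-trans (n≤1+n start) (firstFrom-≥ P (suc start) fuel)

firstFrom-found : ∀ P start fuel {w} → start ≤ w → w < start + fuel → P w ≡ true →
  P (firstFrom P start fuel) ≡ true × firstFrom P start fuel ≤ w
firstFrom-found P start zero {w} s≤w w<s+0 _ = contradiction s≤w (<⇒≱ (subst (w <_) (+-identityʳ start) w<s+0))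
firstFrom-found P start (suc fuel) {w} s≤w w<s+f Pw with P start in Ps
... | true  = Ps , s≤w
... | false with m≤n⇒m<n∨m≡n s≤w
...   | inj₁ s<w  = firstFrom-found P (suc start) fuel s<w (subst (w <_) (+-suc start fuel) w<s+f) Pw
...   | inj₂ refl with () ← trans (sym Ps) Pw

firstFrom-minimal : ∀ P start fuel {j} → start ≤ j → j < firstFrom P start fuel → P j ≡ false
firstFrom-minimal P start zero s≤j j<s = contradiction s≤j (<⇒≱ j<s)
firstFrom-minimal P start (suc fuel) s≤j j<first with P start in Ps
... | true  = contradiction s≤j (<⇒≱ j<first)
... | false with m≤n⇒m<n∨m≡n s≤j
...   | inj₁ s<j  = firstFrom-minimal P (suc start) fuel s<j j<first
...   | inj₂ refl = Ps

allBelow⁺ : ∀ P m → (∀ x → x < m → P x ≡ true) → allBelow P m ≡ true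
allBelow⁺ P zero    _ = refl
allBelow⁺ P (suc m) h rewrite h m ≤-refl = allBelow⁺ P m (λ x x<m → h x (m<n⇒m<1+n x<m))

allBelow⁻ : ∀ P m {x} → allBelow P m ≡ true → x < m → P x ≡ true
allBelow⁻ P (suc m) {x} all x<1+m with P m in Pm | m≤n⇒m<n∨m≡n (s≤s⁻¹ x<1+m)
... | true | inj₁ x<m  = allBelow⁻ P m all x<m
... | true | inj₂ refl = Pm

coprime?⇒Coprime : ∀ {x y} → coprime? x y ≡ true → Coprime x y
coprime?⇒Coprime {x} {y} eq = gcd≡1⇒coprime (does⇒ (gcd x y ≟ 1) eq)

Coprime⇒coprime? : ∀ {x y} → Coprime x y → coprime? x y ≡ true
Coprime⇒coprime? {x} {y} c = dec-true (gcd x y ≟ 1) (coprime⇒gcd≡1 c)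

modEq?⇒≡-mod : ∀ {m x y} → modEq? m x y ≡ true → x ≡ y mod m
modEq?⇒≡-mod {m} {x} {y} eq = mk≡mod (does⇒ (m ∣? ∣ x - y ∣) eq)

≡-mod⇒modEq? : ∀ {m x y} → x ≡ y mod m → modEq? m x y ≡ true
≡-mod⇒modEq? {m} {x} {y} (mk≡mod d) = dec-true (m ∣? ∣ x - y ∣) d

-- Coprimality

coprime-suc : ∀ m → Coprime m (suc m)
coprime-suc m = subst (Coprime m) (+-comm m 1)
  (Coprimality.sym (Coprimality.coprime-+ (Coprimality.1-coprimeTo m)))

coprime-* : ∀ {x y m} → Coprime x m → Coprime y m → Coprime (x * y) m
coprime-* {x} x⊥m y⊥m (d∣xy , d∣m) = y⊥m (coprime-divisor d⊥x d∣xy , d∣m)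
  where
  d⊥x : Coprime _ x
  d⊥x (e∣d , e∣x) = x⊥m (e∣x , ∣-trans e∣d d∣m)

coprime-% : ∀ {x m} .{{_ : NonZero m}} → Coprime x m → Coprime (x % m) m
coprime-% x⊥m (d∣x%m , d∣m) = x⊥m (∣n∣m%n⇒∣m d∣m d∣x%m , d∣m)

coprime-product : ∀ {m} us → All.All (λ u → Coprime u m) us → Coprime (product us) m
coprime-product {m} []       _              = Coprimality.1-coprimeTo m
coprime-product     (u ∷ us) (u⊥m All.∷ us⊥m) = coprime-* u⊥m (coprime-product us us⊥m)

divisor-pos : ∀ {d c} → d ∣ c → 1 ≤ c → 1 ≤ d
divisor-pos {zero} d∣c 1≤c = contradiction (0∣⇒≡0 d∣c) (≢-nonZero⁻¹ _ {{>-nonZero 1≤c}})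
divisor-pos {suc _} _ _ = s≤s z≤n

coprime-∣ : ∀ {a m d} → Coprime a m → d ∣ m → Coprime a d
coprime-∣ a⊥m d∣m (e∣a , e∣d) = a⊥m (e∣a , ∣-trans e∣d d∣m)

coprime-^ˡ : ∀ {x y} e → Coprime x y → Coprime (x ^ e) y
coprime-^ˡ {y = y} zero    _   = Coprimality.1-coprimeTo y
coprime-^ˡ         (suc e) x⊥y = coprime-* x⊥y (coprime-^ˡ e x⊥y)

coprime-^ : ∀ {x y} e f → Coprime x y → Coprime (x ^ e) (y ^ f)
coprime-^ e f x⊥y = Coprimality.sym (coprime-^ˡ f (Coprimality.sym (coprime-^ˡ e x⊥y)))

distinct-primes-coprime : ∀ {p q} → Prime p → Prime q → p ≢ q → Coprime p q
distinct-primes-coprime {p} {q} p-prime q-prime p≢q with <-cmp p q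
... | tri< p<q _ _ = Coprimality.sym (Coprimality.prime⇒coprime q-prime {{prime⇒nonZero p-prime}} p<q)
... | tri≈ _ p≡q _ = contradiction p≡q p≢q
... | tri> _ _ q<p = Coprimality.prime⇒coprime p-prime {{prime⇒nonZero q-prime}} q<p

coprime-*-∣ : ∀ {u v x} → Coprime u v → u ∣ x → v ∣ x → u * v ∣ x
coprime-*-∣ {u} {v} u⊥v u∣x v∣x = subst (_∣ _) lcm≡uv (lcm-least u∣x v∣x)
  where
  lcm≡uv : lcm u v ≡ u * v
  lcm≡uv = trans (sym (*-identityˡ (lcm u v)))
    (trans (cong (_* lcm u v) (sym (coprime⇒gcd≡1 u⊥v))) (gcd*lcm u v))

-- Euler's theorem

unique-⊆⇒↭ : ∀ {a} {A : Set a} {ys xs : List A} → Unique ys → ys ⊆ xs → length ys ≡ length xs → ys ↭ xs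
unique-⊆⇒↭ {ys = []} {xs = []} _ _ _ = ↭-refl
unique-⊆⇒↭ {ys = y ∷ ys} (y∉ys ∷ ys-unique) ys⊆xs len
  with ws , zs , refl ← ∈-∃++ (ys⊆xs (here refl)) =
  ↭-trans (↭-prep y (unique-⊆⇒↭ ys-unique ys⊆ws++zs len′)) (↭-sym (shift y ws zs))
  where
  ys⊆ws++zs : ys ⊆ ws ++ zs
  ys⊆ws++zs z∈ys with ∈-++⁻ ws (ys⊆xs (there z∈ys))
  ... | inj₁ z∈ws         = ∈-++⁺ˡ z∈ws
  ... | inj₂ (here refl)  = contradiction refl (All.lookup y∉ys z∈ys)
  ... | inj₂ (there z∈zs) = ∈-++⁺ʳ ws z∈zs
  len′ : length ys ≡ length (ws ++ zs)
  len′ = suc-injective (trans len (length-++-sucʳ ws y zs))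

coprimeTo? : ∀ m → Decidable (λ x → Coprime x m)
coprimeTo? m x = Coprimality.coprime? x m

units : ℕ → List ℕ
units m = filter (coprimeTo? m) (upTo m)

totient : ℕ → ℕ
totient m = length (units m)

∈-units⁺ : ∀ {m x} → x < m → Coprime x m → x ∈ units m
∈-units⁺ {m} x<m x⊥m = ∈-filter⁺ (coprimeTo? m) (∈-upTo⁺ x<m) x⊥m

∈-units⁻ : ∀ {m x} → x ∈ units m → x < m × Coprime x m
∈-units⁻ {m} x∈units with x∈upTo , x⊥m ← ∈-filter⁻ (coprimeTo? m) x∈units =
  ∈-upTo⁻ x∈upTo , x⊥m

totient≤ : ∀ m → totient m ≤ m
totient≤ m = ≤-trans (length-filter (coprimeTo? m) (upTo m)) (≤-reflexive (length-upTo m))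

totient< : ∀ {m} → 2 ≤ m → totient m < m
totient< {m} 2≤m = subst (totient m <_) (length-upTo m)
  (filter-notAll (coprimeTo? m) (upTo m) (lose (∈-upTo⁺ {m} {0} (≤-trans (s≤s z≤n) 2≤m)) ¬0⊥m))
  where
  ¬0⊥m : ¬ Coprime 0 m
  ¬0⊥m 0⊥m = <⇒≢ 2≤m (sym (Coprimality.0-coprimeTo-m⇒m≡1 0⊥m))

totient-pos : ∀ {m} → 1 ≤ m → 1 ≤ totient m
totient-pos {suc m} _ = filter-some (coprimeTo? (suc m)) (lose (∈-upTo⁺ (n<1+n m)) (coprime-suc m))

product-map-*% : ∀ {m} x us .{{_ : NonZero m}} →
  product (map (λ u → x * u % m) us) ≡ x ^ length us * product us mod m
product-map-*%     x []       = ≡-mod-refl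
product-map-*% {m} x (u ∷ us) = begin
  x * u % m * product (map (λ u → x * u % m) us) ≈⟨ *-cong-mod (≡-mod-sym (≡-mod-% (x * u))) (product-map-*% x us) ⟩
  x * u * (x ^ length us * product us)           ≡⟨ [m*n]*[o*p]≡[m*o]*[n*p] x u _ _ ⟩
  x * x ^ length us * (u * product us)           ∎
  where open ≡-mod-Reasoning m

*-%-injective : ∀ {m x i j} .{{_ : NonZero m}} → Coprime x m → i < m → j < m →
  x * i % m ≡ x * j % m → i ≡ j
*-%-injective {m} {x} {i} {j} x⊥m i<m j<m eq = begin
  i     ≡⟨ m<n⇒m%n≡m i<m ⟨
  i % m ≡⟨ ≡-mod⇒%-≡ (*-cancelˡ-mod (Coprimality.sym x⊥m) (%-≡⇒≡-mod eq)) ⟩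
  j % m ≡⟨ m<n⇒m%n≡m j<m ⟩
  j     ∎
  where open ≡-Reasoning

-- Multiplication by x permutes the units modulo m, so it fixes their product.
euler : ∀ {m x} .{{_ : NonZero m}} → Coprime x m → x ^ totient m ≡ 1 mod m
euler {m} {x} x⊥m = *-cancelˡ-mod (Coprimality.sym (coprime-product U U-coprime)) (begin
  product U * x ^ totient m  ≡⟨ *-comm (product U) _ ⟩
  x ^ length U * product U   ≈⟨ product-map-*% x U ⟨
  product (map f U)          ≡⟨ product-↭ (unique-⊆⇒↭ image-unique image-⊆ (length-map f U)) ⟩
  product U                  ≡⟨ *-identityʳ (product U) ⟨
  product U * 1              ∎)
  where
  open ≡-mod-Reasoning m
  U : List ℕ
  U = units m
  f : ℕ → ℕ
  f u = x * u % m
  U-coprime : All.All (λ u → Coprime u m) U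
  U-coprime = All.tabulate (λ u∈U → proj₂ (∈-units⁻ u∈U))
  image-⊆ : map f U ⊆ U
  image-⊆ v∈fU with u , u∈U , refl ← ∈-map⁻ f v∈fU =
    ∈-units⁺ (m%n<n (x * u) m) (coprime-% (coprime-* x⊥m (proj₂ (∈-units⁻ u∈U))))
  f-distinct : ∀ {i j} → i < j → j < m → f i ≢ f j
  f-distinct i<j j<m fi≡fj = <⇒≢ i<j (*-%-injective x⊥m (<-trans i<j j<m) j<m fi≡fj)
  image-unique : Unique (map f U)
  image-unique = AllPairs.map⁺ (AllPairs.filter⁺ (coprimeTo? m) (AllPairs.applyUpTo⁺₁ id m f-distinct))

-- Carmichael's function and multiplicative order

universalExponent? : ℕ → ℕ → Bool
universalExponent? n e = allBelow (λ x → not (coprime? x n) ∨ modEq? n (x ^ e) 1) n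

universalExponent?⁺ : ∀ {n} e → (∀ {x} → Coprime x n → x ^ e ≡ 1 mod n) → universalExponent? n e ≡ true
universalExponent?⁺ {n} e h = allBelow⁺ _ n test
  where
  test : ∀ x → x < n → (not (coprime? x n) ∨ modEq? n (x ^ e) 1) ≡ true
  test x _ with coprime? x n in x⊥n
  ... | false = refl
  ... | true  = ≡-mod⇒modEq? (h (coprime?⇒Coprime x⊥n))

universalExponent?⁻ : ∀ {n a} e .{{_ : NonZero n}} → universalExponent? n e ≡ true →
  Coprime a n → a ^ e ≡ 1 mod n
universalExponent?⁻ {n} {a} e univ a⊥n = ≡-mod-trans (^-cong-mod e (≡-mod-% a)) (modEq?⇒≡-mod test)
  where
  test : modEq? n ((a % n) ^ e) 1 ≡ true
  test with allBelow⁻ _ n univ (m%n<n a n)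
  ... | holds rewrite Coprime⇒coprime? (coprime-% {a} a⊥n) = holds

carmichael-spec : ∀ n .{{_ : NonZero n}} →
  universalExponent? n (carmichael n) ≡ true × carmichael n ≤ totient n
carmichael-spec n = firstFrom-found (universalExponent? n) 1 n (totient-pos (>-nonZero⁻¹ n))
  (s≤s (totient≤ n)) (universalExponent?⁺ (totient n) euler)

carmichael-pos : ∀ n → 1 ≤ carmichael n
carmichael-pos n = firstFrom-≥ (universalExponent? n) 1 n

carmichael-< : ∀ {n} → 2 ≤ n → carmichael n < n
carmichael-< {n@(suc _)} 2≤n = ≤-<-trans (proj₂ (carmichael-spec n)) (totient< 2≤n)

carmichael-1 : carmichael 1 ≡ 1
carmichael-1 = refl

^carmichael≡1 : ∀ {n a} .{{_ : NonZero n}} → Coprime a n → a ^ carmichael n ≡ 1 mod n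
^carmichael≡1 {n} = universalExponent?⁻ (carmichael n) (proj₁ (carmichael-spec n))

ord-pos : ∀ m a → 1 ≤ ord m a
ord-pos m a = firstFrom-≥ (λ k → modEq? m (a ^ k) 1) 1 m

^ord≡1 : ∀ {m a} .{{_ : NonZero m}} → Coprime a m → a ^ ord m a ≡ 1 mod m
^ord≡1 {m} {a} a⊥m = modEq?⇒≡-mod (proj₁ (firstFrom-found (λ k → modEq? m (a ^ k) 1) 1 m
  (totient-pos (>-nonZero⁻¹ m)) (s≤s (totient≤ m)) (≡-mod⇒modEq? (euler a⊥m))))

ord-∣ : ∀ {m a N} .{{_ : NonZero m}} → Coprime a m → a ^ N ≡ 1 mod m → ord m a ∣ N
ord-∣ {m} {a} {N} a⊥m aᴺ≡1 with ord m a | ord-pos m a | ^ord≡1 a⊥m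
  | firstFrom-minimal (λ k → modEq? m (a ^ k) 1) 1 m
... | o@(suc _) | _ | aᵒ≡1 | minimal with N % o in N%o
...   | zero  = m%n≡0⇒n∣m N o N%o
...   | suc r = contradiction (trans (sym (minimal (s≤s z≤n) r<o)) (≡-mod⇒modEq? aʳ≡1)) λ ()
  where
  r<o : suc r < o
  r<o = subst (_< o) N%o (m%n<n N o)
  aʳ≡1 : a ^ suc r ≡ 1 mod m
  aʳ≡1 = ≡-mod-trans (≡-mod-sym (subst (λ e → a ^ N ≡ a ^ e mod m) N%o (^-%-mod N aᵒ≡1))) aᴺ≡1

∣-lcmUpTo : ∀ f {i} k → i ≤ k → f i ∣ lcmUpTo f k
∣-lcmUpTo f zero    z≤n = ∣-refl
∣-lcmUpTo f (suc k) i≤1+k with m≤n⇒m<n∨m≡n i≤1+k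
... | inj₁ i<1+k = ∣-trans (∣-lcmUpTo f k (s≤s⁻¹ i<1+k)) (m∣lcm[m,n] (lcmUpTo f k) (f (suc k)))
... | inj₂ refl  = n∣lcm[m,n] (lcmUpTo f k) (f (suc k))

iter-stays-1 : ∀ f {x i j} → f 1 ≡ 1 → iter f i x ≡ 1 → i ≤ j → iter f j x ≡ 1
iter-stays-1 f f1≡1 fⁱx≡1 i≤j = go (≤⇒≤′ i≤j)
  where
  go : ∀ {j} → _ ≤′ j → iter f j _ ≡ 1
  go ≤′-refl        = fⁱx≡1
  go (≤′-step i≤′j) = trans (cong f (go i≤′j)) f1≡1

module _ (f : ℕ → ℕ) (f-pos : ∀ m → 1 ≤ f m) (f1≡1 : f 1 ≡ 1) (f-< : ∀ {m} → 2 ≤ m → f m < m) where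

  private
    iter-pos : ∀ {x} i → 1 ≤ x → 1 ≤ iter f i x
    iter-pos zero    1≤x = 1≤x
    iter-pos (suc i) _   = f-pos _

    iter-descent : ∀ {x} i → 1 ≤ x → iter f i x ≡ 1 ⊎ iter f i x + i ≤ x
    iter-descent zero _ = inj₂ (≤-reflexive (+-identityʳ _))
    iter-descent {x} (suc i) 1≤x with iter-descent i 1≤x
    ... | inj₁ fⁱx≡1 = inj₁ (trans (cong f fⁱx≡1) f1≡1)
    ... | inj₂ bound with iter f i x | iter-pos i 1≤x
    ...   | suc zero        | _ = inj₁ f1≡1
    ...   | v@(suc (suc _)) | _ = inj₂ (begin
      f v + suc i   ≡⟨ +-suc (f v) i ⟩
      suc (f v + i) ≤⟨ +-monoˡ-≤ i (f-< (s≤s (s≤s z≤n))) ⟩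
      v + i         ≤⟨ bound ⟩
      x             ∎)
      where open ≤-Reasoning

  iter-≡1 : ∀ {x i} → 1 ≤ x → x ≤ i → iter f i x ≡ 1
  iter-≡1 {x} 1≤x x≤i with iter-descent x 1≤x
  ... | inj₁ fˣx≡1 = iter-stays-1 f f1≡1 fˣx≡1 x≤i
  ... | inj₂ bound = contradiction bound (<⇒≱ (+-monoˡ-< x (iter-pos x 1≤x)))

carmichaelIter-pos : ∀ {n} → 1 ≤ n → ∀ i → 1 ≤ carmichaelIter i n
carmichaelIter-pos 1≤n zero    = 1≤n
carmichaelIter-pos {n} _ (suc i) = carmichael-pos (carmichaelIter i n)

carmichaelIter-≡1 : ∀ {n i} → 1 ≤ n → n ≤ i → carmichaelIter i n ≡ 1
carmichaelIter-≡1 = iter-≡1 carmichael carmichael-pos carmichael-1 carmichael-<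

carmichaelIter-H≡1 : ∀ {n} → 1 ≤ n → carmichaelIter (H n) n ≡ 1
carmichaelIter-H≡1 {n} 1≤n = does⇒ (carmichaelIter (H n) n ≟ 1)
  (proj₁ (firstFrom-found (λ α → does (carmichaelIter α n ≟ 1)) 0 (suc n) z≤n ≤-refl
    (dec-true (carmichaelIter n n ≟ 1) (carmichaelIter-≡1 1≤n ≤-refl))))

coprime-carmichaelIter : ∀ {n a} → 1 ≤ n → Coprime a (Lc n) → ∀ i → Coprime a (carmichaelIter i n)
coprime-carmichaelIter {n} {a} 1≤n a⊥L i with i ≤? H n
... | yes i≤H = coprime-∣ a⊥L (∣-lcmUpTo (λ α → carmichaelIter α n) (H n) i≤H)
... | no  i≰H rewrite iter-stays-1 carmichael carmichael-1 (carmichaelIter-H≡1 1≤n) (<⇒≤ (≰⇒> i≰H)) =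
  Coprimality.sym (Coprimality.1-coprimeTo a)

V-coprime : ∀ {a} m → Coprime m a → V a m ≡ m
V-coprime zero    _   = refl
V-coprime (suc k) m⊥a rewrite dec-true (suc k ∣? suc k) ∣-refl | Coprime⇒coprime? m⊥a = refl

-- Towers of exponentials modulo a chain of orders

tet-≡-mod-tower : ∀ {a r} (m : ℕ → ℕ) → (∀ i → a ^ m (suc i) ≡ 1 mod m i) → (∀ i → a ≡ r mod m i) →
  ∀ k i → tet a k ≡ tet r k mod m i
tet-≡-mod-tower m _ _ zero _ = ≡-mod-refl
tet-≡-mod-tower {a} {r} m aᵐ≡1 a≡r (suc k) i = begin
  a ^ tet a k ≈⟨ ^-cong-mod (tet a k) (a≡r i) ⟩
  r ^ tet a k ≈⟨ ^-cong-exponent rᵐ≡1 (tet-≡-mod-tower m aᵐ≡1 a≡r k (suc i)) ⟩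
  r ^ tet r k ∎
  where
  open ≡-mod-Reasoning (m i)
  rᵐ≡1 : r ^ m (suc i) ≡ 1 mod m i
  rᵐ≡1 = ≡-mod-trans (≡-mod-sym (^-cong-mod (m (suc i)) (a≡r i))) (aᵐ≡1 i)

module OrderChain {n a : ℕ} (1≤n : 1 ≤ n) (a⊥L : Coprime a (Lc n)) where

  private
    c m : ℕ → ℕ
    c i = carmichaelIter i n
    m i = ordIter i n a

    m∣c : ∀ i → m i ∣ c i
    m-pos : ∀ i → 1 ≤ m i
    a⊥m : ∀ i → Coprime a (m i)
    m-suc : ∀ i → m (suc i) ≡ ord (m i) a

    m-pos i = divisor-pos (m∣c i) (carmichaelIter-pos 1≤n i)
    a⊥m i = coprime-∣ (coprime-carmichaelIter 1≤n a⊥L i) (m∣c i)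
    m-suc i = cong (λ v → ord v a) (V-coprime (m i) (Coprimality.sym (a⊥m i)))

    m∣c zero    = ∣-refl
    m∣c (suc i) = subst (_∣ c (suc i)) (sym (m-suc i))
      (ord-∣ {{>-nonZero (m-pos i)}} (a⊥m i)
        (≡-mod-∣ (m∣c i)
          (^carmichael≡1 {{>-nonZero (carmichaelIter-pos 1≤n i)}} (coprime-carmichaelIter 1≤n a⊥L i))))

    ^m-suc≡1 : ∀ i → a ^ m (suc i) ≡ 1 mod m i
    ^m-suc≡1 i rewrite m-suc i = ^ord≡1 {{>-nonZero (m-pos i)}} (a⊥m i)

    m≡1 : ∀ {i} → n ≤ i → m i ≡ 1
    m≡1 {i} n≤i = ∣1⇒≡1 (subst (m i ∣_) (carmichaelIter-≡1 1≤n n≤i) (m∣c i))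

    ≡-mod-m : ∀ {r} → a ≡ r mod La a n → ∀ i → a ≡ r mod m i
    ≡-mod-m a≡r i with i ≤? n
    ... | yes i≤n = ≡-mod-∣ (∣-lcmUpTo (λ j → ordIter j n a) n i≤n) a≡r
    ... | no  i≰n rewrite m≡1 (<⇒≤ (≰⇒> i≰n)) = ≡-mod-1

  tet-≡-mod-La : ∀ {r} → a ≡ r mod La a n → ∀ k → tet a k ≡ tet r k mod n
  tet-≡-mod-La a≡r k = tet-≡-mod-tower m ^m-suc≡1 (≡-mod-m a≡r) k 0

-- Levels of towers

Pairwise-coprime : ∀ {l} → (Fin l → ℕ) → Set
Pairwise-coprime q = ∀ i j → i ≢ j → Coprime (q i) (q j)

∣-prodF : ∀ {l} (q : Fin l → ℕ) i → q i ∣ prodF q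
∣-prodF q Fin.zero    = m∣m*n _
∣-prodF q (Fin.suc i) = ∣-trans (∣-prodF (λ j → q (Fin.suc j)) i) (n∣m*n (q Fin.zero))

coprime-prodF : ∀ {l y} (q : Fin l → ℕ) → (∀ i → Coprime (q i) y) → Coprime (prodF q) y
coprime-prodF {zero}  {y} q _   = Coprimality.1-coprimeTo y
coprime-prodF {suc l}     q q⊥y =
  coprime-* (q⊥y Fin.zero) (coprime-prodF (λ j → q (Fin.suc j)) (λ j → q⊥y (Fin.suc j)))

prodF-∣ : ∀ {l x} (q : Fin l → ℕ) → Pairwise-coprime q → (∀ i → q i ∣ x) → prodF q ∣ x
prodF-∣ {zero}  {x} q _  _   = 1∣ x
prodF-∣ {suc l}     q pc q∣x = coprime-*-∣
  (Coprimality.sym (coprime-prodF (λ j → q (Fin.suc j)) (λ j → pc (Fin.suc j) Fin.zero λ ())))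
  (q∣x Fin.zero)
  (prodF-∣ (λ j → q (Fin.suc j))
    (λ i j i≢j → pc (Fin.suc i) (Fin.suc j) (i≢j ∘ Finₚ.suc-injective))
    (λ j → q∣x (Fin.suc j)))

maxF-ub : ∀ {l} (f : Fin l → ℕ) i → f i ≤ maxF f
maxF-ub f Fin.zero    = m≤m⊔n _ _
maxF-ub f (Fin.suc i) = ≤-trans (maxF-ub (λ j → f (Fin.suc j)) i) (m≤n⊔m (f Fin.zero) _)

maxF-lub : ∀ {l b} (f : Fin l → ℕ) → (∀ i → f i ≤ b) → maxF f ≤ b
maxF-lub {zero}  f _    = z≤n
maxF-lub {suc l} f f≤b = ⊔-lub (f≤b Fin.zero) (maxF-lub (λ j → f (Fin.suc j)) (λ j → f≤b (Fin.suc j)))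

Stable-∣ : ∀ {d n a t} → d ∣ n → Stable n a t → Stable d a t
Stable-∣ d∣n stable k t≤k = ∣-trans d∣n (stable k t≤k)

Stable-mono : ∀ {n a s t} → Stable n a s → s ≤ t → Stable n a t
Stable-mono {a = a} {s} {t} stable s≤t k t≤k =
  ∣-diff (≡-mod-trans (mk≡mod {tet a k} (stable k (≤-trans s≤t t≤k)))
                      (≡-mod-sym (mk≡mod {tet a t} (stable t s≤t))))

Stable-prodF : ∀ {l a t} (q : Fin l → ℕ) → Pairwise-coprime q → (∀ i → Stable (q i) a t) → Stable (prodF q) a t
Stable-prodF q pc stable k t≤k = prodF-∣ q pc (λ i → stable i k t≤k)

IsLev-prodF : ∀ {l a t} {q ts : Fin l → ℕ} → Pairwise-coprime q →
  IsLev (prodF q) a t → (∀ i → IsLev (q i) a (ts i)) → t ≡ maxF ts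
IsLev-prodF {t = t} {q} {ts} pc (stable , least) lev = ≤-antisym
  (least (maxF ts) (Stable-prodF q pc (λ i → Stable-mono (proj₁ (lev i)) (maxF-ub ts i))))
  (maxF-lub ts (λ i → proj₂ (lev i) t (Stable-∣ (∣-prodF q i) stable)))

Stable-cong : ∀ {n a b t} → (∀ k → tet a k ≡ tet b k mod n) → Stable n a t → Stable n b t
Stable-cong {t = t} a≡b stable k t≤k =
  ∣-diff (≡-mod-trans (≡-mod-sym (a≡b k)) (≡-mod-trans (mk≡mod (stable k t≤k)) (a≡b t)))

IsLev-cong : ∀ {n a b t} → (∀ k → tet a k ≡ tet b k mod n) → IsLev n a t → IsLev n b t
IsLev-cong a≡b (stable , least) = Stable-cong a≡b stable , λ s st → least s (Stable-cong (≡-mod-sym ∘ a≡b) st)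

IsLev-unique : ∀ {n a t s} → IsLev n a t → IsLev n a s → t ≡ s
IsLev-unique (stable , least) (stable′ , least′) = ≤-antisym (least _ stable′) (least′ _ stable)

lev-prime-factorisation : ∀ n a l (p e : Fin l → ℕ) → (∀ i → Prime (p i)) → (∀ i j → p i ≡ p j → i ≡ j) →
  n ≡ prodF (λ i → p i ^ e i) → ∀ t ts → IsLev n a t → (∀ i → IsLev (p i ^ e i) a (ts i)) → t ≡ maxF ts
lev-prime-factorisation _ _ _ p e p-prime p-inj refl _ _ = IsLev-prodF pc
  where
  pc : Pairwise-coprime (λ i → p i ^ e i)
  pc i j i≢j = coprime-^ (e i) (e j) (distinct-primes-coprime (p-prime i) (p-prime j) (i≢j ∘ p-inj i j))

lev-residue-La : ∀ n a r → 1 ≤ n → Coprime a (Lc n) → a ≡ r mod La a n →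
  ∀ t s → IsLev n a t → IsLev n r s → t ≡ s
lev-residue-La n a r 1≤n a⊥L a≡r _ _ lev-a = IsLev-unique (IsLev-cong (OrderChain.tet-≡-mod-La 1≤n a⊥L a≡r) lev-a)

lemma5p7 : (n a : ℕ) → 1 ≤ n →
    ((l : ℕ) (p e : Fin l → ℕ) → (∀ i → Prime (p i)) → (∀ i j → p i ≡ p j → i ≡ j) →
      (∀ i → 1 ≤ e i) → n ≡ prodF (λ i → p i ^ e i) →
      (t : ℕ) (ts : Fin l → ℕ) → IsLev n a t → (∀ i → IsLev (p i ^ e i) a (ts i)) →
      t ≡ maxF ts)
    ×
    (Coprime a (Lc n) → (r : ℕ) → r < La a n → ModEq (La a n) a r →
      (t s : ℕ) → IsLev n a t → IsLev n r s → t ≡ s)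
lemma5p7 n a 1≤n =
  (λ l p e p-prime p-inj _ → lev-prime-factorisation n a l p e p-prime p-inj) ,
  (λ a⊥L r _ a≡r → lev-residue-La n a r 1≤n a⊥L (mk≡mod a≡r))
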